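{- Let $n\ge 2$ and $k$ be integers with $1\le k\le n-1$. Then ${d^\ast}^k_n = n\, d^{k-1}_{n-1}$.
   Context: Permutations of $[n]=\{1,\dots,n\}$ are written in one-line notation $p=p(1)p(2)\cdots p(n)$. For integers $N\ge 1$ and $1\le m\le N-1$, $d^m_N$ denotes the number of permutations $p$ of $[N]$ containing no adjacent pair $j(j+m)$ with $1\le j\le N-m$, i.e. there is no $i\in\{1,\dots,N-1\}$ with $p(i+1)=p(i)+m$; equivalently $d^m_N=\sum_{j=0}^{N-m}(-1)^j\binom{N-m}{j}(N-j)!$. For $m=0$, $d^0_N$ denotes the derangement number $\mathrm{Der}(N)=\sum_{j=0}^{N}(-1)^j\binom{N}{j}(N-j)!$ (the value of the same formula at $m=0$). ${d^\ast}^k_n$ denotes the number of permutations $p$ of $[n]$ with no circular $k$-succession among the forbidden pairs $j(j+k)$, $1\le j\le n-k$: that is, there is no $i\in\{1,\dots,n-1\}$ with $p(i+1)=p(i)+k$, and moreover $p(1)\ne p(n)+k$. -}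

module Defs where

open import Data.Nat using (ℕ; zero; suc; _+_; _≟_)
open import Data.Product using (_×_; _,_; proj₁; proj₂)
open import Data.List using (List; []; _∷_; [_]; map; concatMap; applyUpTo; filter; length; _++_; zip)
open import Data.List.Relation.Unary.All using (All; all?)
open import Data.List.Relation.Unary.Unique.Propositional using (Unique)
open import Data.List.Relation.Unary.Unique.DecPropositional _≟_ using (unique?)
open import Relation.Nullary using (¬_; Dec)
open import Relation.Nullary.Decidable using (¬?)
open import Relation.Binary.PropositionalEquality using (_≡_; _≢_)

-- A permutation p of [n] = {1,…,n} in one-line notation p(1)p(2)…p(n) is
-- represented as the list [p(1), …, p(n)].

range : ℕ → List ℕ
range n = applyUpTo suc n

words : ℕ → ℕ → List (List ℕ)
words n zero    = [ [] ]
words n (suc l) = concatMap (λ x → map (x ∷_) (words n l)) (range n)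

perms : ℕ → List (List ℕ)
perms n = filter (λ w → unique? w) (words n n)

adjPairs : List ℕ → List (ℕ × ℕ)
adjPairs []           = []
adjPairs (x ∷ [])     = []
adjPairs (x ∷ y ∷ xs) = (x , y) ∷ adjPairs (y ∷ xs)

lastOf : ℕ → List ℕ → ℕ
lastOf x []       = x
lastOf x (y ∷ ys) = lastOf y ys

wrapPair : List ℕ → List (ℕ × ℕ)
wrapPair []       = []
wrapPair (x ∷ xs) = (lastOf x xs , x) ∷ []

NotSucc : ℕ → ℕ × ℕ → Set
NotSucc m (a , b) = b ≢ a + m

notSucc? : (m : ℕ) → (q : ℕ × ℕ) → Dec (NotSucc m q)
notSucc? m (a , b) = ¬? (b ≟ a + m)

NoSucc : ℕ → List ℕ → Set
NoSucc m p = All (NotSucc m) (adjPairs p)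

NoCircSucc : ℕ → List ℕ → Set
NoCircSucc k p = All (NotSucc k) (adjPairs p ++ wrapPair p)

NoFix : List ℕ → Set
NoFix p = All (λ (q : ℕ × ℕ) → proj₁ q ≢ proj₂ q) (zip p (range (length p)))

noFix? : (p : List ℕ) → Dec (NoFix p)
noFix? p = all? (λ q → ¬? (proj₁ q ≟ proj₂ q)) (zip p (range (length p)))

Der : ℕ → ℕ
Der N = length (filter noFix? (perms N))

-- d^m_N: for m ≥ 1 the number of permutations of [N] with no adjacent j(j+m);
-- for m = 0, d^0_N = Der(N) (convention of the paper)
d : ℕ → ℕ → ℕ
d zero    N = Der N
d (suc m) N = length (filter (λ p → all? (notSucc? (suc m)) (adjPairs p)) (perms N))

dstar : ℕ → ℕ → ℕ
dstar k n = length (filter (λ p → all? (notSucc? k) (adjPairs p ++ wrapPair p)) (perms n))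

-- Rotating a circular arrangement until it starts with 1 gives d*ᵏₙ = n · r, where r counts the
-- permutations of [n] starting with 1 without circular k-succession; for these the wrap-around pair
-- (p(n), 1) is harmless, so only the linear k-successions matter. To compare r with d^{k-1}_{n-1},
-- both are embedded in families indexed by a threshold e that only forbid the patterns sitting at
-- values (resp. positions) ≤ e: k-successions j(j+k) for r, and (k-1)-successions or, for k = 1,
-- fixed points for d. At e = 0 both count (n-1)!, and both obey f(N+1, e) = f(N+1, e+1) + f(N, e):
-- the permutations lost when e grows exhibit the pattern at e + 1, and deleting its last value (the
-- fixed point itself, for d) and closing the gap is a bijection onto those of [N] counted at e.

module Submission where

open import Defs
open import Data.Bool using (Bool; true; false)
open import Data.Empty using (⊥; ⊥-elim)
open import Data.Unit using (⊤; tt)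
open import Data.Nat using (ℕ; zero; suc; pred; _+_; _*_; _∸_; _≤_; _<_; z≤n; s≤s; _≟_; _<?_)
open import Data.Nat.Properties
open import Data.Product as Product using (_×_; _,_; proj₁; proj₂; ∃₂)
open import Data.Product.Properties using (≡-dec)
open import Data.Sum using (inj₁; inj₂)
open import Data.List
  using (List; []; _∷_; [_]; _++_; map; filter; length; applyUpTo; zip; take; drop; break; cartesianProduct)
open import Data.List.Properties
  using ( ∷-injective; ++-assoc; ++-identityʳ; map-++; map-∘; map-id-local; take++drop≡id
        ; length-take; length-map; length-++; length-++-sucʳ; length-++-comm; length-applyUpTo
        ; filter-++; filter-accept; filter-reject; filter-all )
open import Data.List.Membership.Propositional using (_∈_; _∉_)
open import Data.List.Membership.Propositional.Properties
open import Data.List.Membership.DecPropositional _≟_ using (_∈?_)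
open import Data.List.Membership.DecPropositional (≡-dec _≟_ _≟_) using () renaming (_∈?_ to _∈²?_)
open import Data.List.Relation.Binary.Subset.Propositional using (_⊆_)
open import Data.List.Relation.Binary.Permutation.Propositional
  using (_↭_; ↭-sym; ↭-reflexive; ↭⇒↭ₛ; module PermutationReasoning)
open import Data.List.Relation.Binary.Permutation.Propositional.Properties using (shift; ++-comm; All-resp-↭)
open import Data.List.Relation.Unary.All as All using (All; []; _∷_; all?)
import Data.List.Relation.Unary.All.Properties as All
open import Data.List.Relation.Unary.Any using (here; there)
open import Data.List.Relation.Unary.AllPairs as AllPairs using ([]; _∷_)
import Data.List.Relation.Unary.AllPairs.Properties as AllPairs
open import Data.List.Relation.Unary.Unique.Propositional using (Unique)
import Data.List.Relation.Unary.Unique.Propositional.Properties as Unique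
open import Data.List.Relation.Unary.Unique.DecPropositional _≟_ using (unique?)
open import Function using (_∘_)
open import Relation.Nullary using (¬_; Dec; yes; no; ¬?; _×-dec_; _→-dec_)
open import Relation.Nullary.Decidable using (decidable-stable)
open import Relation.Unary using (Decidable; ∁; _∩_)
open import Relation.Unary.Properties using (∁?; _∩?_)
open import Relation.Binary.PropositionalEquality hiding ([_])
import Data.List.Relation.Binary.Permutation.Setoid.Properties (setoid ℕ) as ↭ₛ

module _ {A : Set} where

  length-≤-⊆ : {xs ys : List A} → Unique xs → xs ⊆ ys → length xs ≤ length ys
  length-≤-⊆ {[]}     _           _   = z≤n
  length-≤-⊆ {x ∷ xs} (x∉xs ∷ xs!) xs⊆ys with ∈-∃++ (xs⊆ys (here refl))
  ... | us , vs , refl = begin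
    suc (length xs)         ≤⟨ s≤s (length-≤-⊆ xs! xs⊆us++vs) ⟩
    suc (length (us ++ vs)) ≡⟨ length-++-sucʳ us x vs ⟨
    length (us ++ x ∷ vs)   ∎
    where
    open ≤-Reasoning
    xs⊆us++vs : xs ⊆ us ++ vs
    xs⊆us++vs {y} y∈xs with ∈-++⁻ us (xs⊆ys (there y∈xs))
    ... | inj₁ y∈us         = ∈-++⁺ˡ y∈us
    ... | inj₂ (here refl)  = ⊥-elim (All.All¬⇒¬Any x∉xs y∈xs)
    ... | inj₂ (there y∈vs) = ∈-++⁺ʳ us y∈vs

take-++-length : {A : Set} (u v : List A) → take (length u) (u ++ v) ≡ u
take-++-length []      v = refl
take-++-length (x ∷ u) v = cong (x ∷_) (take-++-length u v)

drop-++-length : {A : Set} (u v : List A) → drop (length u) (u ++ v) ≡ v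
drop-++-length []      v = refl
drop-++-length (x ∷ u) v = drop-++-length u v

∈∧∉⇒≢ : {A : Set} {x y : A} {xs : List A} → x ∈ xs → y ∉ xs → x ≢ y
∈∧∉⇒≢ x∈ y∉ refl = y∉ x∈

module _ {A B : Set} where

  record Bijection (xs : List A) (ys : List B) : Set where
    field
      to      : A → B
      from    : B → A
      to-∈    : ∀ {x} → x ∈ xs → to x ∈ ys
      from-∈  : ∀ {y} → y ∈ ys → from y ∈ xs
      from∘to : ∀ {x} → x ∈ xs → from (to x) ≡ x
      to∘from : ∀ {y} → y ∈ ys → to (from y) ≡ y

  Unique-map-retraction : {xs : List A} (f : A → B) (g : B → A) →
    (∀ {x} → x ∈ xs → g (f x) ≡ x) → Unique xs → Unique (map f xs)
  Unique-map-retraction f g gf [] = []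
  Unique-map-retraction {x ∷ xs} f g gf (x∉xs ∷ xs!) =
    All.map⁺ (All.tabulate fx≢fy) ∷ Unique-map-retraction f g (λ x∈ → gf (there x∈)) xs!
    where
    fx≢fy : ∀ {y} → y ∈ xs → f x ≢ f y
    fx≢fy y∈xs fx≡fy = All.lookup x∉xs y∈xs (trans (sym (gf (here refl))) (trans (cong g fx≡fy) (gf (there y∈xs))))

  length-≤-retraction : {xs : List A} {ys : List B} (f : A → B) (g : B → A) →
    Unique xs → (∀ {x} → x ∈ xs → f x ∈ ys) → (∀ {x} → x ∈ xs → g (f x) ≡ x) → length xs ≤ length ys
  length-≤-retraction {xs} {ys} f g xs! f∈ gf = begin
    length xs         ≡⟨ length-map f xs ⟨
    length (map f xs) ≤⟨ length-≤-⊆ (Unique-map-retraction f g gf xs!) image⊆ ⟩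
    length ys         ∎
    where
    open ≤-Reasoning
    image⊆ : map f xs ⊆ ys
    image⊆ y∈ with ∈-map⁻ f y∈
    ... | x , x∈xs , refl = f∈ x∈xs

  length-cartesianProduct : (xs : List A) (ys : List B) → length (cartesianProduct xs ys) ≡ length xs * length ys
  length-cartesianProduct []       ys = refl
  length-cartesianProduct (x ∷ xs) ys = begin
    length (map (x ,_) ys ++ cartesianProduct xs ys)         ≡⟨ length-++ (map (x ,_) ys) ⟩
    length (map (x ,_) ys) + length (cartesianProduct xs ys) ≡⟨ cong₂ _+_ (length-map (x ,_) ys) (length-cartesianProduct xs ys) ⟩
    length ys + length xs * length ys                        ∎
    where open ≡-Reasoning

length-Bijection : {A B : Set} {xs : List A} {ys : List B} → Unique xs → Unique ys → Bijection xs ys →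
  length xs ≡ length ys
length-Bijection xs! ys! φ = ≤-antisym
  (length-≤-retraction to from xs! to-∈ from∘to)
  (length-≤-retraction from to ys! from-∈ to∘from)
  where open Bijection φ

module _ {A : Set} {P Q : A → Set} (P? : Decidable P) (Q? : Decidable Q) where

  length-filter-congOn : (xs : List A) → (∀ {x} → x ∈ xs → P x → Q x) → (∀ {x} → x ∈ xs → Q x → P x) →
    length (filter P? xs) ≡ length (filter Q? xs)
  length-filter-congOn []       _   _   = refl
  length-filter-congOn (x ∷ xs) P⇒Q Q⇒P with P? x | Q? x
  ... | yes _  | yes _  = cong suc (length-filter-congOn xs (λ m → P⇒Q (there m)) (λ m → Q⇒P (there m)))
  ... | yes px | no ¬qx = ⊥-elim (¬qx (P⇒Q (here refl) px))
  ... | no ¬px | yes qx = ⊥-elim (¬px (Q⇒P (here refl) qx))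
  ... | no _   | no _   = length-filter-congOn xs (λ m → P⇒Q (there m)) (λ m → Q⇒P (there m))

  length-filter-⊆ : (∀ {x} → P x → Q x) → (xs : List A) →
    length (filter Q? xs) ≡ length (filter P? xs) + length (filter (Q? ∩? ∁? P?) xs)
  length-filter-⊆ P⇒Q []       = refl
  length-filter-⊆ P⇒Q (x ∷ xs) with P? x | Q? x
  ... | yes _  | yes _  = cong suc (length-filter-⊆ P⇒Q xs)
  ... | yes px | no ¬qx = ⊥-elim (¬qx (P⇒Q px))
  ... | no _   | yes _  = trans (cong suc (length-filter-⊆ P⇒Q xs)) (sym (+-suc _ _))
  ... | no _   | no _   = length-filter-⊆ P⇒Q xs

InRange : ℕ → ℕ → Set
InRange n x = 1 ≤ x × x ≤ n

∈-range⁻ : ∀ {n x} → x ∈ range n → InRange n x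
∈-range⁻ x∈ with ∈-applyUpTo⁻ suc x∈
... | i , i<n , refl = s≤s z≤n , i<n

∈-range⁺ : ∀ {n x} → InRange n x → x ∈ range n
∈-range⁺ {x = suc x} (_ , x<n) = ∈-applyUpTo⁺ suc x<n

Unique-range : ∀ n → Unique (range n)
Unique-range n = Unique.applyUpTo⁺₁ suc n (λ i<j _ → <⇒≢ i<j ∘ suc-injective)

∈-words⁻ : ∀ n l {w} → w ∈ words n l → length w ≡ l × All (InRange n) w
∈-words⁻ n zero    (here refl) = refl , []
∈-words⁻ n (suc l) w∈ with ∈-concat⁻′ (map (λ x → map (x ∷_) (words n l)) (range n)) w∈
... | ws , w∈ws , ws∈ with ∈-map⁻ (λ x → map (x ∷_) (words n l)) ws∈
... | x , x∈ , refl with ∈-map⁻ (x ∷_) w∈ws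
... | v , v∈ , refl with ∈-words⁻ n l v∈
... | |v|≡l , v⊆ = cong suc |v|≡l , ∈-range⁻ x∈ ∷ v⊆

∈-words⁺ : ∀ n l {w} → length w ≡ l → All (InRange n) w → w ∈ words n l
∈-words⁺ n zero    {[]}    refl []         = here refl
∈-words⁺ n (suc l) {x ∷ w} refl (x∈ ∷ w⊆) =
  ∈-concat⁺′ (∈-map⁺ (x ∷_) (∈-words⁺ n l refl w⊆))
             (∈-map⁺ (λ y → map (y ∷_) (words n l)) (∈-range⁺ x∈))

Unique-words : ∀ n l → Unique (words n l)
Unique-words n zero    = [] ∷ []
Unique-words n (suc l) = Unique.concat⁺
  (All.map⁺ (All.tabulate (λ _ → Unique.map⁺ (proj₂ ∘ ∷-injective) (Unique-words n l))))
  (AllPairs.map⁺ (AllPairs.map disjoint (Unique-range n)))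
  where
  disjoint : ∀ {x y} → x ≢ y → ∀ {w} → ¬ (w ∈ map (x ∷_) (words n l) × w ∈ map (y ∷_) (words n l))
  disjoint x≢y (w∈x , w∈y) with ∈-map⁻ _ w∈x | ∈-map⁻ _ w∈y
  ... | _ , _ , refl | _ , _ , eq = x≢y (proj₁ (∷-injective eq))

record IsPerm (n : ℕ) (p : List ℕ) : Set where
  field
    unique : Unique p
    length≡ : length p ≡ n
    inRange : All (InRange n) p

∈-perms⁻ : ∀ {n p} → p ∈ perms n → IsPerm n p
∈-perms⁻ {n} p∈ with ∈-filter⁻ unique? {xs = words n n} p∈
... | p∈words , p! with ∈-words⁻ n n p∈words
... | |p|≡n , p⊆ = record { unique = p! ; length≡ = |p|≡n ; inRange = p⊆ }

∈-perms⁺ : ∀ {n p} → IsPerm n p → p ∈ perms n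
∈-perms⁺ {n} π = ∈-filter⁺ unique? (∈-words⁺ n n length≡ inRange) unique
  where open IsPerm π

Unique-perms : ∀ n → Unique (perms n)
Unique-perms n = Unique.filter⁺ unique? (Unique-words n n)

-- Pigeonhole: otherwise x ∷ p would be n + 1 distinct values in [n].
∈-IsPerm : ∀ {n p x} → IsPerm n p → InRange n x → x ∈ p
∈-IsPerm {n} {p} {x} π x∈[n] with x ∈? p
... | yes x∈p = x∈p
... | no  x∉p = ⊥-elim (<-irrefl refl (begin-strict
  n                  ≡⟨ sym length≡ ⟩
  length p           <⟨ n<1+n _ ⟩
  length (x ∷ p)     ≤⟨ length-≤-⊆ (All.¬Any⇒All¬ p x∉p ∷ unique) x∷p⊆range ⟩
  length (range n)   ≡⟨ length-applyUpTo suc n ⟩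
  n                  ∎))
  where
  open IsPerm π
  open ≤-Reasoning
  x∷p⊆range : x ∷ p ⊆ range n
  x∷p⊆range (here refl) = ∈-range⁺ x∈[n]
  x∷p⊆range (there y∈p) = ∈-range⁺ (All.lookup inRange y∈p)

Unique-resp-↭ : {xs ys : List ℕ} → xs ↭ ys → Unique xs → Unique ys
Unique-resp-↭ xs↭ys = ↭ₛ.Unique-resp-↭ (↭⇒↭ₛ xs↭ys)

Unique-insert : ∀ {x} u v → x ∉ u ++ v → Unique (u ++ v) → Unique (u ++ x ∷ v)
Unique-insert {x} u v x∉ uv! =
  Unique-resp-↭ (↭-sym (shift x u v)) (All.¬Any⇒All¬ (u ++ v) x∉ ∷ uv!)

Unique-remove : ∀ {x} u v → Unique (u ++ x ∷ v) → x ∉ u ++ v × Unique (u ++ v)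
Unique-remove {x} u v u++x∷v! with Unique-resp-↭ (shift x u v) u++x∷v!
... | x∉ ∷ uv! = All.All¬⇒¬Any x∉ , uv!

Unique-∉ˡ : ∀ {x} u v → Unique (u ++ x ∷ v) → x ∉ u
Unique-∉ˡ u v u++x∷v! = proj₁ (Unique-remove u v u++x∷v!) ∘ ∈-++⁺ˡ

-- Relabelling values around a gap

punchIn : ℕ → ℕ → ℕ
punchIn s x with x <? s
... | yes _ = x
... | no  _ = suc x

punchOut : ℕ → ℕ → ℕ
punchOut s x with s <? x
... | yes _ = pred x
... | no  _ = x

punchIn-< : ∀ {s x} → x < s → punchIn s x ≡ x
punchIn-< {s} {x} x<s with x <? s
... | yes _   = refl
... | no  x≮s = ⊥-elim (x≮s x<s)

punchIn≢ : ∀ s x → punchIn s x ≢ s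
punchIn≢ s x with x <? s
... | yes x<s = <⇒≢ x<s
... | no  x≮s = x≮s ∘ ≤-reflexive

punchOut-≤ : ∀ {s x} → x ≤ s → punchOut s x ≡ x
punchOut-≤ {s} {x} x≤s with s <? x
... | yes s<x = ⊥-elim (<⇒≱ s<x x≤s)
... | no  _   = refl

punchOut-punchIn : ∀ s x → punchOut s (punchIn s x) ≡ x
punchOut-punchIn s x with x <? s
... | yes x<s = punchOut-≤ (<⇒≤ x<s)
... | no  x≮s with s <? suc x
...   | yes _     = refl
...   | no  s≮1+x = ⊥-elim (s≮1+x (s≤s (≮⇒≥ x≮s)))

punchIn-injective : ∀ s {x y} → punchIn s x ≡ punchIn s y → x ≡ y
punchIn-injective s {x} {y} eq = begin
  x                        ≡⟨ punchOut-punchIn s x ⟨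
  punchOut s (punchIn s x) ≡⟨ cong (punchOut s) eq ⟩
  punchOut s (punchIn s y) ≡⟨ punchOut-punchIn s y ⟩
  y                        ∎
  where open ≡-Reasoning

punchIn-punchOut : ∀ {s x} → x ≢ s → punchIn s (punchOut s x) ≡ x
punchIn-punchOut {s} {x} x≢s with s <? x
punchIn-punchOut {s} {suc x} x≢s | yes s<1+x with x <? s
... | yes x<s = ⊥-elim (<-irrefl refl (≤-trans x<s (≤-pred s<1+x)))
... | no  _   = refl
punchIn-punchOut {s} {x} x≢s | no s≮x = punchIn-< (≤∧≢⇒< (≮⇒≥ s≮x) x≢s)

punchIn-≡-< : ∀ {s x i} → punchIn s x ≡ i → i < s → x ≡ i
punchIn-≡-< {s} {x} eq i<s with x <? s
... | yes _   = eq
... | no  x≮s = ⊥-elim (<⇒≱ i<s (≤-trans (≮⇒≥ x≮s) (≤-trans (n≤1+n x) (≤-reflexive eq))))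

punchOut-≡-< : ∀ {s x i} → punchOut s x ≡ i → i < s → x ≡ i
punchOut-≡-< {s} {suc x} eq i<s with s <? suc x
... | yes s<1+x = ⊥-elim (<⇒≱ i<s (subst (s ≤_) eq (≤-pred s<1+x)))
... | no  _     = eq
punchOut-≡-< {s} {zero} eq i<s = eq

InRange-punchIn : ∀ {N s x} → InRange N x → InRange (suc N) (punchIn s x)
InRange-punchIn {N} {s} {x} (1≤x , x≤N) with x <? s
... | yes _ = 1≤x , m≤n⇒m≤1+n x≤N
... | no  _ = m≤n⇒m≤1+n 1≤x , s≤s x≤N

InRange-punchOut : ∀ {N s x} → InRange (suc N) s → InRange (suc N) x → x ≢ s → InRange N (punchOut s x)
InRange-punchOut {N} {s} {x} (1≤s , s≤1+N) (1≤x , x≤1+N) x≢s with s <? x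
InRange-punchOut {N} {s} {suc x} (1≤s , _) (_ , x≤1+N) _ | yes s<1+x = ≤-trans 1≤s (≤-pred s<1+x) , ≤-pred x≤1+N
... | no  s≮x = 1≤x , ≤-pred (≤-trans (≤∧≢⇒< (≮⇒≥ s≮x) x≢s) s≤1+N)

⊆-insert : ∀ {x : ℕ} u v → u ++ v ⊆ u ++ x ∷ v
⊆-insert u v y∈ with ∈-++⁻ u y∈
... | inj₁ y∈u = ∈-++⁺ˡ y∈u
... | inj₂ y∈v = ∈-++⁺ʳ u (there y∈v)

erase : ℕ → List ℕ → List ℕ
erase s = filter (λ x → ¬? (x ≟ s))

erase-mid : ∀ {s} u v → s ∉ u ++ v → erase s (u ++ s ∷ v) ≡ u ++ v
erase-mid {s} u v s∉ = begin
  erase s (u ++ s ∷ v)         ≡⟨ filter-++ _ u (s ∷ v) ⟩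
  erase s u ++ erase s (s ∷ v) ≡⟨ cong (erase s u ++_) (filter-reject _ {xs = v} (λ s≢s → s≢s refl)) ⟩
  erase s u ++ erase s v       ≡⟨ cong₂ _++_ (filter-all _ (≢s (∈-++⁺ˡ {ys = v}))) (filter-all _ (≢s (∈-++⁺ʳ u))) ⟩
  u ++ v                       ∎
  where
  open ≡-Reasoning
  ≢s : ∀ {w} → w ⊆ u ++ v → All (_≢ s) w
  ≢s w⊆ = All.tabulate (λ x∈ → ∈∧∉⇒≢ (w⊆ x∈) s∉)

closeGap : ℕ → List ℕ → List ℕ
closeGap s p = map (punchOut s) (erase s p)

closeGap-mid : ∀ {s} u v → s ∉ u ++ v → closeGap s (u ++ s ∷ v) ≡ map (punchOut s) (u ++ v)
closeGap-mid {s} u v s∉ = cong (map (punchOut s)) (erase-mid u v s∉)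

IsPerm-closeGap : ∀ {N s} u v → IsPerm (suc N) (u ++ s ∷ v) → IsPerm N (closeGap s (u ++ s ∷ v))
IsPerm-closeGap {N} {s} u v π = subst (IsPerm N) (sym (closeGap-mid u v s∉)) (record
  { unique  = Unique-map-retraction (punchOut s) (punchIn s) (λ x∈ → punchIn-punchOut (∈∧∉⇒≢ x∈ s∉)) uv!
  ; length≡ = begin
      length (map (punchOut s) (u ++ v)) ≡⟨ length-map (punchOut s) (u ++ v) ⟩
      length (u ++ v)                    ≡⟨ suc-injective (trans (sym (length-++-sucʳ u s v)) length≡) ⟩
      N                                  ∎
  ; inRange = All.map⁺ (All.tabulate (λ x∈ → InRange-punchOut s∈[N] (All.lookup inRange (⊆-insert {s} u v x∈)) (∈∧∉⇒≢ x∈ s∉)))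
  })
  where
  open IsPerm π
  open ≡-Reasoning
  s∉ = proj₁ (Unique-remove u v unique)
  uv! = proj₂ (Unique-remove u v unique)
  s∈[N] : InRange (suc N) s
  s∈[N] = All.lookup inRange (∈-insert u)

∉-map-punchIn : ∀ s q → s ∉ map (punchIn s) q
∉-map-punchIn s q s∈ with ∈-map⁻ (punchIn s) s∈
... | x , _ , s≡ = punchIn≢ s x (sym s≡)

IsPerm-openGap : ∀ {N s q} u v → InRange (suc N) s → u ++ v ≡ map (punchIn s) q → IsPerm N q →
  IsPerm (suc N) (u ++ s ∷ v)
IsPerm-openGap {N} {s} {q} u v s∈[N] uv≡ π = record
  { unique  = Unique-insert u v (subst (s ∉_) (sym uv≡) s∉) (subst Unique (sym uv≡) q↑!)
  ; length≡ = begin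
      length (u ++ s ∷ v)          ≡⟨ length-++-sucʳ u s v ⟩
      suc (length (u ++ v))        ≡⟨ cong (suc ∘ length) uv≡ ⟩
      suc (length (map (punchIn s) q)) ≡⟨ cong suc (trans (length-map (punchIn s) q) length≡) ⟩
      suc N                        ∎
  ; inRange = All.tabulate inRange′
  }
  where
  open IsPerm π
  open ≡-Reasoning
  q↑! : Unique (map (punchIn s) q)
  q↑! = Unique.map⁺ (punchIn-injective s) unique
  s∉ = ∉-map-punchIn s q
  fromImage : ∀ {y} → y ∈ u ++ v → InRange (suc N) y
  fromImage y∈ with ∈-map⁻ (punchIn s) (subst (_ ∈_) uv≡ y∈)
  ... | x , x∈q , refl = InRange-punchIn (All.lookup inRange x∈q)
  inRange′ : ∀ {y} → y ∈ u ++ s ∷ v → InRange (suc N) y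
  inRange′ y∈ with ∈-++⁻ u y∈
  ... | inj₂ (here refl) = s∈[N]
  ... | inj₁ y∈u = fromImage (∈-++⁺ˡ y∈u)
  ... | inj₂ (there y∈v) = fromImage (∈-++⁺ʳ u y∈v)

closeGap-openGap : ∀ {s q} u v → u ++ v ≡ map (punchIn s) q → closeGap s (u ++ s ∷ v) ≡ q
closeGap-openGap {s} {q} u v uv≡ = begin
  closeGap s (u ++ s ∷ v)              ≡⟨ closeGap-mid u v s∉ ⟩
  map (punchOut s) (u ++ v)            ≡⟨ cong (map (punchOut s)) uv≡ ⟩
  map (punchOut s) (map (punchIn s) q) ≡⟨ sym (map-∘ q) ⟩
  map (punchOut s ∘ punchIn s) q       ≡⟨ map-id-local (All.tabulate (λ {x} _ → punchOut-punchIn s x)) ⟩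
  q                                    ∎
  where
  open ≡-Reasoning
  s∉ : s ∉ u ++ v
  s∉ = ∉-map-punchIn s q ∘ subst (s ∈_) uv≡

openGap-closeGap : ∀ {s} u v → s ∉ u ++ v → map (punchIn s) (closeGap s (u ++ s ∷ v)) ≡ u ++ v
openGap-closeGap {s} u v s∉ = begin
  map (punchIn s) (closeGap s (u ++ s ∷ v))       ≡⟨ cong (map (punchIn s)) (closeGap-mid u v s∉) ⟩
  map (punchIn s) (map (punchOut s) (u ++ v))     ≡⟨ sym (map-∘ (u ++ v)) ⟩
  map (punchIn s ∘ punchOut s) (u ++ v)           ≡⟨ map-id-local (All.tabulate (λ x∈ → punchIn-punchOut (∈∧∉⇒≢ x∈ s∉))) ⟩
  u ++ v                                          ∎
  where open ≡-Reasoning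

adjPairs-++-∷ : ∀ u (z : ℕ) w → adjPairs (u ++ z ∷ w) ≡ adjPairs (u ++ [ z ]) ++ adjPairs (z ∷ w)
adjPairs-++-∷ []          z w = refl
adjPairs-++-∷ (x ∷ [])    z w = refl
adjPairs-++-∷ (x ∷ y ∷ u) z w = cong ((x , y) ∷_) (adjPairs-++-∷ (y ∷ u) z w)

∈-adjPairs⁻ : ∀ {a b} p → (a , b) ∈ adjPairs p → ∃₂ λ u v → p ≡ u ++ a ∷ b ∷ v
∈-adjPairs⁻ (x ∷ y ∷ p) (here refl) = [] , p , refl
∈-adjPairs⁻ (x ∷ y ∷ p) (there ab∈) with ∈-adjPairs⁻ (y ∷ p) ab∈
... | u , v , eq = x ∷ u , v , cong (x ∷_) eq

∈-adjPairs⁺ : ∀ {a b} u v → (a , b) ∈ adjPairs (u ++ a ∷ b ∷ v)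
∈-adjPairs⁺ []          v = here refl
∈-adjPairs⁺ (x ∷ [])    v = there (here refl)
∈-adjPairs⁺ (x ∷ y ∷ u) v = there (∈-adjPairs⁺ (y ∷ u) v)

∈-adjPairs-∈ : ∀ {a b} p → (a , b) ∈ adjPairs p → b ∈ p
∈-adjPairs-∈ (x ∷ y ∷ p) (here refl) = there (here refl)
∈-adjPairs-∈ (x ∷ y ∷ p) (there ab∈) = there (∈-adjPairs-∈ (y ∷ p) ab∈)

module _ {P : ℕ × ℕ → Set} where

  All-adjPairs-map : ∀ (f : ℕ → ℕ) → (∀ {a b} → P (a , b) → P (f a , f b)) →
    ∀ p → All P (adjPairs p) → All P (adjPairs (map f p))
  All-adjPairs-map f f-pres []          _          = []
  All-adjPairs-map f f-pres (x ∷ [])    _          = []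
  All-adjPairs-map f f-pres (x ∷ y ∷ p) (pxy ∷ ps) = f-pres pxy ∷ All-adjPairs-map f f-pres (y ∷ p) ps

  All-adjPairs-∷ : ∀ x w → (∀ {y} → P (x , y)) → All P (adjPairs w) → All P (adjPairs (x ∷ w))
  All-adjPairs-∷ x []      _   _  = []
  All-adjPairs-∷ x (y ∷ w) pxy ps = pxy ∷ ps

  All-adjPairs-tail : ∀ x w → All P (adjPairs (x ∷ w)) → All P (adjPairs w)
  All-adjPairs-tail x []      _        = []
  All-adjPairs-tail x (y ∷ w) (_ ∷ ps) = ps

  -- Inserting or deleting y right after x only touches pairs starting at x or y.
  All-adjPairs-insertAfter : ∀ u x y v → (∀ {z} → P (x , z)) → (∀ {z} → P (y , z)) →
    All P (adjPairs (u ++ x ∷ v)) → All P (adjPairs (u ++ x ∷ y ∷ v))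
  All-adjPairs-insertAfter u x y v Px Py ps
    with All.++⁻ (adjPairs (u ++ [ x ])) (subst (All P) (adjPairs-++-∷ u x v) ps)
  ... | ps-u , ps-v = subst (All P) (sym (adjPairs-++-∷ u x (y ∷ v)))
    (All.++⁺ ps-u (Px ∷ All-adjPairs-∷ y v Py (All-adjPairs-tail x v ps-v)))

  All-adjPairs-deleteAfter : ∀ u x y v → (∀ {z} → P (x , z)) →
    All P (adjPairs (u ++ x ∷ y ∷ v)) → All P (adjPairs (u ++ x ∷ v))
  All-adjPairs-deleteAfter u x y v Px ps
    with All.++⁻ (adjPairs (u ++ [ x ])) (subst (All P) (adjPairs-++-∷ u x (y ∷ v)) ps)
  ... | ps-u , _ ∷ ps-v = subst (All P) (sym (adjPairs-++-∷ u x v))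
    (All.++⁺ ps-u (All-adjPairs-∷ x v Px (All-adjPairs-tail y v ps-v)))

-- Permutations whose m-successions all start above e

SuccAbove : ℕ → ℕ → ℕ × ℕ → Set
SuccAbove m e (a , b) = b ≡ a + m → e < a

NoLowSucc : ℕ → ℕ → List ℕ → Set
NoLowSucc m e p = All (SuccAbove m e) (adjPairs p)

noLowSucc? : ∀ m e p → Dec (NoLowSucc m e p)
noLowSucc? m e p = all? (λ (a , b) → (b ≟ a + m) →-dec (e <? a)) (adjPairs p)

Anchored : Bool → List ℕ → Set
Anchored false _       = ⊤
Anchored true  []      = ⊥
Anchored true  (x ∷ _) = x ≡ 1

anchored? : ∀ b p → Dec (Anchored b p)
anchored? false _       = yes tt
anchored? true  []      = no λ ()
anchored? true  (x ∷ _) = x ≟ 1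

#NoLowSucc : Bool → ℕ → ℕ → ℕ → ℕ
#NoLowSucc b m N e = length (filter (anchored? b ∩? noLowSucc? m e) (perms N))

NoLowSucc-weaken : ∀ {m e} p → NoLowSucc m (suc e) p → NoLowSucc m e p
NoLowSucc-weaken {e = e} p = All.map (λ above b≡ → <-trans (n<1+n e) (above b≡))

SuccAbove-punchIn : ∀ {m e a b} → SuccAbove m e (a , b) →
  SuccAbove m e (punchIn (suc e + m) a , punchIn (suc e + m) b)
SuccAbove-punchIn {m} {e} {a} {b} above with a <? suc e + m | b <? suc e + m
... | no  a≮s | _       = λ _ → ≤-trans (m≤m+n (suc e) m) (≤-trans (≮⇒≥ a≮s) (n≤1+n a))
... | yes _   | yes _   = above
... | yes _   | no  b≮s = λ 1+b≡ → +-cancelʳ-≤ m (suc e) a (≤-trans (≮⇒≥ b≮s) (≤-trans (n≤1+n b) (≤-reflexive 1+b≡)))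

SuccAbove-punchOut : ∀ {m e a b} → SuccAbove m e (a , b) →
  SuccAbove m e (punchOut (suc e + m) a , punchOut (suc e + m) b)
SuccAbove-punchOut {m} {e} {a} {b} above with suc e + m <? a | suc e + m <? b
SuccAbove-punchOut {m} {e} {suc a} {b} above | yes s<1+a | _ = λ _ → ≤-trans (m≤m+n (suc e) m) (≤-pred s<1+a)
... | no _ | no _ = above
SuccAbove-punchOut {m} {e} {a} {suc b} above | no _ | yes s<1+b =
  λ b≡ → +-cancelʳ-≤ m (suc e) a (≤-trans (≤-pred s<1+b) (≤-reflexive b≡))

NoLowSucc-punchIn : ∀ {m e} p → NoLowSucc m e p → NoLowSucc m e (map (punchIn (suc e + m)) p)
NoLowSucc-punchIn = All-adjPairs-map _ SuccAbove-punchIn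

NoLowSucc-punchOut : ∀ {m e} p → NoLowSucc m e p → NoLowSucc m e (map (punchOut (suc e + m)) p)
NoLowSucc-punchOut = All-adjPairs-map _ SuccAbove-punchOut

Anchored-punchIn : ∀ {s} b q → 1 < s → Anchored b q → Anchored b (map (punchIn s) q)
Anchored-punchIn false q       _   _    = tt
Anchored-punchIn true  (x ∷ q) 1<s refl = punchIn-< 1<s

Anchored-closeGap : ∀ {s} b p → 1 < s → Anchored b p → Anchored b (closeGap s p)
Anchored-closeGap false p       _   _    = tt
Anchored-closeGap {s} true  (x ∷ p) 1<s refl
  rewrite filter-accept (λ x → ¬? (x ≟ s)) {xs = p} (<⇒≢ 1<s) = punchOut-≤ (<⇒≤ 1<s)

NoLowSucc-step : ∀ {m e} p → NoLowSucc m e p → (suc e , suc e + m) ∉ adjPairs p → NoLowSucc m (suc e) p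
NoLowSucc-step {m} {e} p above unjoined = All.tabulate step
  where
  step : ∀ {ac} → ac ∈ adjPairs p → SuccAbove m (suc e) ac
  step {a , c} ac∈ c≡ = ≤∧≢⇒< (All.lookup above ac∈ c≡) λ { refl → unjoined (subst (λ z → (a , z) ∈ adjPairs p) c≡ ac∈) }

NoLowSucc-positive : ∀ {m} p → All (1 ≤_) p → NoLowSucc m 0 p
NoLowSucc-positive []          _           = []
NoLowSucc-positive (x ∷ [])    _           = []
NoLowSucc-positive (x ∷ y ∷ p) (1≤x ∷ 1≤ys) = (λ _ → 1≤x) ∷ NoLowSucc-positive (y ∷ p) 1≤ys

NoLowSucc⇒NoSucc : ∀ {m N} p → All (_≤ N) p → NoLowSucc m (N ∸ m) p → NoSucc m p
NoLowSucc⇒NoSucc {m} {N} p ≤N above = All.tabulate λ {(a , b)} ab∈ b≡a+m →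
  <⇒≱ (All.lookup above ab∈ b≡a+m) (m+n≤o⇒m≤o∸n a (subst (_≤ N) b≡a+m (All.lookup ≤N (∈-adjPairs-∈ p ab∈))))

NoSucc⇒NoLowSucc : ∀ {m e} p → NoSucc m p → NoLowSucc m e p
NoSucc⇒NoLowSucc p = All.map (λ b≢a+m b≡a+m → ⊥-elim (b≢a+m b≡a+m))

insertAfter : ℕ → ℕ → List ℕ → List ℕ
insertAfter t s []       = []
insertAfter t s (x ∷ xs) with x ≟ t
... | yes _ = x ∷ s ∷ xs
... | no  _ = x ∷ insertAfter t s xs

insertAfter-mid : ∀ {t s} u v → t ∉ u → insertAfter t s (u ++ t ∷ v) ≡ u ++ t ∷ s ∷ v
insertAfter-mid {t} [] v _ with t ≟ t
... | yes _   = refl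
... | no  t≢t = ⊥-elim (t≢t refl)
insertAfter-mid {t} (x ∷ u) v t∉ with x ≟ t
... | yes x≡t = ⊥-elim (t∉ (here (sym x≡t)))
... | no  _   = cong (x ∷_) (insertAfter-mid u v (t∉ ∘ there))

Anchored-insertAfter : ∀ {t s} b w → Anchored b w → Anchored b (insertAfter t s w)
Anchored-insertAfter         false w       _    = tt
Anchored-insertAfter {t} {s} true  (x ∷ w) refl with 1 ≟ t
... | yes _ = refl
... | no  _ = refl

-- The perms counted at e but not at e + 1 are those in which t = e + 1 is followed by s = t + m;
-- deleting s and closing the gap maps them bijectively onto the perms of [N] counted at e.
module SuccessionRecurrence (b : Bool) {m e N : ℕ} (0<m : 0 < m) (s≤1+N : suc e + m ≤ suc N) where

  private
    t s : ℕ
    t = suc e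
    s = suc e + m

    Cond : ℕ → List ℕ → Set
    Cond e′ = Anchored b ∩ NoLowSucc m e′

    cond? : ∀ e′ → Decidable (Cond e′)
    cond? e′ = anchored? b ∩? noLowSucc? m e′

    lost? : Decidable (Cond e ∩ ∁ (Cond (suc e)))
    lost? = cond? e ∩? ∁? (cond? (suc e))

    t<s : t < s
    t<s = m<m+n t 0<m

    1<s : 1 < s
    1<s = s≤s (≤-trans 0<m (m≤n+m m e))

    t≤N : t ≤ N
    t≤N = ≤-pred (≤-trans t<s s≤1+N)

    _↑ : List ℕ → List ℕ
    u ↑ = map (punchIn s) u

    [t]-assoc : ∀ u v → (u ++ [ t ]) ++ s ∷ v ≡ u ++ t ∷ s ∷ v
    [t]-assoc u v = ++-assoc u [ t ] (s ∷ v)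

    joined : ∀ {p} → p ∈ filter lost? (perms (suc N)) → ∃₂ λ u v → p ≡ u ++ t ∷ s ∷ v
    joined {p} p∈ with ∈-filter⁻ lost? {xs = perms (suc N)} p∈
    ... | _ , (anchored , above) , ¬above′ = ∈-adjPairs⁻ p (decidable-stable ((t , s) ∈²? adjPairs p)
          λ unjoined → ¬above′ (anchored , NoLowSucc-step p above unjoined))

    opened : ∀ {q} → IsPerm N q → ∃₂ λ u v → q ≡ u ++ t ∷ v × t ∉ u
    opened π with ∈-∃++ (∈-IsPerm π (s≤s z≤n , t≤N))
    ... | u , v , refl = u , v , refl , Unique-∉ˡ u v (IsPerm.unique π)

    to : List ℕ → List ℕ
    to = closeGap s

    from : List ℕ → List ℕ
    from q = insertAfter t s (q ↑)

    to-mid : ∀ u v → Unique (u ++ t ∷ s ∷ v) → to (u ++ t ∷ s ∷ v) ≡ map (punchOut s) (u ++ t ∷ v)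
    to-mid u v p! = begin
      closeGap s (u ++ t ∷ s ∷ v)          ≡⟨ cong (closeGap s) ([t]-assoc u v) ⟨
      closeGap s ((u ++ [ t ]) ++ s ∷ v)   ≡⟨ closeGap-mid (u ++ [ t ]) v s∉ ⟩
      map (punchOut s) ((u ++ [ t ]) ++ v) ≡⟨ cong (map (punchOut s)) (++-assoc u [ t ] v) ⟩
      map (punchOut s) (u ++ t ∷ v)        ∎
      where
      open ≡-Reasoning
      s∉ = proj₁ (Unique-remove (u ++ [ t ]) v (subst Unique (sym ([t]-assoc u v)) p!))

    ↑-mid : ∀ u v → (u ++ t ∷ v) ↑ ≡ (u ↑ ++ [ t ]) ++ v ↑
    ↑-mid u v = begin
      (u ++ t ∷ v) ↑               ≡⟨ map-++ (punchIn s) u (t ∷ v) ⟩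
      u ↑ ++ punchIn s t ∷ v ↑     ≡⟨ cong (λ z → u ↑ ++ z ∷ v ↑) (punchIn-< t<s) ⟩
      u ↑ ++ t ∷ v ↑               ≡⟨ ++-assoc (u ↑) [ t ] (v ↑) ⟨
      (u ↑ ++ [ t ]) ++ v ↑        ∎
      where open ≡-Reasoning

    from-mid : ∀ u v → t ∉ u → from (u ++ t ∷ v) ≡ u ↑ ++ t ∷ s ∷ v ↑
    from-mid u v t∉u = begin
      insertAfter t s ((u ++ t ∷ v) ↑)        ≡⟨ cong (insertAfter t s) (↑-mid u v) ⟩
      insertAfter t s ((u ↑ ++ [ t ]) ++ v ↑) ≡⟨ cong (insertAfter t s) (++-assoc (u ↑) [ t ] (v ↑)) ⟩
      insertAfter t s (u ↑ ++ t ∷ v ↑)        ≡⟨ insertAfter-mid (u ↑) (v ↑) t∉u↑ ⟩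
      u ↑ ++ t ∷ s ∷ v ↑                      ∎
      where
      open ≡-Reasoning
      t∉u↑ : t ∉ u ↑
      t∉u↑ t∈ with ∈-map⁻ (punchIn s) t∈
      ... | x , x∈u , t≡ = t∉u (subst (_∈ u) (punchIn-≡-< (sym t≡) t<s) x∈u)

    to-∈ : ∀ {p} → p ∈ filter lost? (perms (suc N)) → to p ∈ filter (cond? e) (perms N)
    to-∈ {p} p∈ with ∈-filter⁻ lost? {xs = perms (suc N)} p∈ | joined p∈
    ... | p∈perms , (anchored , above) , _ | u , v , refl =
      ∈-filter⁺ (cond? e) (∈-perms⁺ π) (Anchored-closeGap b p 1<s anchored , above↓)
      where
      π₀ = ∈-perms⁻ p∈perms
      π : IsPerm N (to p)
      π = subst (IsPerm N ∘ closeGap s) ([t]-assoc u v)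
            (IsPerm-closeGap (u ++ [ t ]) v (subst (IsPerm (suc N)) (sym ([t]-assoc u v)) π₀))
      above↓ : NoLowSucc m e (to p)
      above↓ = subst (NoLowSucc m e) (sym (to-mid u v (IsPerm.unique π₀)))
        (NoLowSucc-punchOut (u ++ t ∷ v) (All-adjPairs-deleteAfter u t s v (λ _ → n<1+n e) above))

    from-∈ : ∀ {q} → q ∈ filter (cond? e) (perms N) → from q ∈ filter lost? (perms (suc N))
    from-∈ {q} q∈ with ∈-filter⁻ (cond? e) {xs = perms N} q∈
    ... | q∈perms , anchored , above with opened (∈-perms⁻ q∈perms)
    ... | u , v , refl , t∉u = ∈-filter⁺ lost? (∈-perms⁺ π)
      ((Anchored-insertAfter b _ (Anchored-punchIn b q 1<s anchored) , above↑) , λ (_ , above′) →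
        <-irrefl refl (All.lookup above′ (subst (λ w → (t , s) ∈ adjPairs w) (sym (from-mid u v t∉u)) (∈-adjPairs⁺ (u ↑) (v ↑))) refl))
      where
      π : IsPerm (suc N) (from q)
      π = subst (IsPerm (suc N)) (trans ([t]-assoc (u ↑) (v ↑)) (sym (from-mid u v t∉u)))
            (IsPerm-openGap (u ↑ ++ [ t ]) (v ↑) (s≤s z≤n , s≤1+N) (sym (↑-mid u v)) (∈-perms⁻ q∈perms))
      above↑ : NoLowSucc m e (from q)
      above↑ = subst (NoLowSucc m e) (sym (from-mid u v t∉u))
        (All-adjPairs-insertAfter (u ↑) t s (v ↑) (λ _ → n<1+n e) (λ _ → <-trans (n<1+n e) t<s)
          (subst (NoLowSucc m e) (trans (↑-mid u v) (++-assoc (u ↑) [ t ] (v ↑))) (NoLowSucc-punchIn q above)))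

    from∘to : ∀ {p} → p ∈ filter lost? (perms (suc N)) → from (to p) ≡ p
    from∘to {p} p∈ with joined p∈
    ... | u , v , refl = begin
      insertAfter t s (closeGap s (u ++ t ∷ s ∷ v) ↑)        ≡⟨ cong (λ w → insertAfter t s (closeGap s w ↑)) ([t]-assoc u v) ⟨
      insertAfter t s (closeGap s ((u ++ [ t ]) ++ s ∷ v) ↑) ≡⟨ cong (insertAfter t s) (openGap-closeGap (u ++ [ t ]) v s∉) ⟩
      insertAfter t s ((u ++ [ t ]) ++ v)                    ≡⟨ cong (insertAfter t s) (++-assoc u [ t ] v) ⟩
      insertAfter t s (u ++ t ∷ v)                           ≡⟨ insertAfter-mid u v t∉u ⟩
      u ++ t ∷ s ∷ v                                         ∎
      where
      open ≡-Reasoning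
      p! = IsPerm.unique (∈-perms⁻ {suc N} (proj₁ (∈-filter⁻ lost? {xs = perms (suc N)} p∈)))
      s∉ = proj₁ (Unique-remove (u ++ [ t ]) v (subst Unique (sym ([t]-assoc u v)) p!))
      t∉u = Unique-∉ˡ u (s ∷ v) p!

    to∘from : ∀ {q} → q ∈ filter (cond? e) (perms N) → to (from q) ≡ q
    to∘from {q} q∈ with opened (∈-perms⁻ {N} (proj₁ (∈-filter⁻ (cond? e) {xs = perms N} q∈)))
    ... | u , v , refl , t∉u = begin
      closeGap s (from (u ++ t ∷ v))             ≡⟨ cong (closeGap s) (trans (from-mid u v t∉u) (sym ([t]-assoc (u ↑) (v ↑)))) ⟩
      closeGap s ((u ↑ ++ [ t ]) ++ s ∷ v ↑)     ≡⟨ closeGap-openGap (u ↑ ++ [ t ]) (v ↑) (sym (↑-mid u v)) ⟩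
      u ++ t ∷ v                                 ∎
      where open ≡-Reasoning

  #NoLowSucc-recurrence : #NoLowSucc b m (suc N) e ≡ #NoLowSucc b m (suc N) (suc e) + #NoLowSucc b m N e
  #NoLowSucc-recurrence = trans
    (length-filter-⊆ (cond? (suc e)) (cond? e) (Product.map₂ (NoLowSucc-weaken _)) (perms (suc N)))
    (cong (#NoLowSucc b m (suc N) (suc e) +_) (length-Bijection
      (Unique.filter⁺ lost? (Unique-perms (suc N))) (Unique.filter⁺ (cond? e) (Unique-perms N))
      (record { to = to ; from = from ; to-∈ = to-∈ ; from-∈ = from-∈ ; from∘to = from∘to ; to∘from = to∘from })))

-- Permutations with no fixed point at a position ≤ e

-- The entries of p are read as sitting at the positions i, i + 1, ….
NoLowFixFrom : ℕ → ℕ → List ℕ → Set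
NoLowFixFrom e i []       = ⊤
NoLowFixFrom e i (x ∷ xs) = (x ≡ i → e < i) × NoLowFixFrom e (suc i) xs

noLowFixFrom? : ∀ e i p → Dec (NoLowFixFrom e i p)
noLowFixFrom? e i []       = yes tt
noLowFixFrom? e i (x ∷ xs) = ((x ≟ i) →-dec (e <? i)) ×-dec noLowFixFrom? e (suc i) xs

NoLowFix : ℕ → List ℕ → Set
NoLowFix e = NoLowFixFrom e 1

#NoLowFix : ℕ → ℕ → ℕ
#NoLowFix N e = length (filter (noLowFixFrom? e 1) (perms N))

NoLowFixFrom-weaken : ∀ {e} i p → NoLowFixFrom (suc e) i p → NoLowFixFrom e i p
NoLowFixFrom-weaken i []       _                = tt
NoLowFixFrom-weaken i (x ∷ xs) (above , aboves) = (λ x≡i → <-trans (n<1+n _) (above x≡i)) , NoLowFixFrom-weaken (suc i) xs aboves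

NoLowFixFrom-beyond : ∀ {e i} → e < i → ∀ w → NoLowFixFrom e i w
NoLowFixFrom-beyond e<i []      = tt
NoLowFixFrom-beyond e<i (x ∷ w) = (λ _ → e<i) , NoLowFixFrom-beyond (m<n⇒m<1+n e<i) w

NoLowFixFrom-++⁻ : ∀ {e} i u w → NoLowFixFrom e i (u ++ w) → NoLowFixFrom e i u × NoLowFixFrom e (i + length u) w
NoLowFixFrom-++⁻ i []      w nf = tt , subst (λ j → NoLowFixFrom _ j w) (sym (+-identityʳ i)) nf
NoLowFixFrom-++⁻ {e} i (x ∷ u) w (above , nf) with NoLowFixFrom-++⁻ (suc i) u w nf
... | nf-u , nf-w = (above , nf-u) , subst (λ j → NoLowFixFrom e j w) (sym (+-suc i (length u))) nf-w

NoLowFixFrom-++⁺ : ∀ {e} i u w → NoLowFixFrom e i u → NoLowFixFrom e (i + length u) w → NoLowFixFrom e i (u ++ w)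
NoLowFixFrom-++⁺ i []      w _              nf-w = subst (λ j → NoLowFixFrom _ j w) (+-identityʳ i) nf-w
NoLowFixFrom-++⁺ {e} i (x ∷ u) w (above , nf-u) nf-w =
  above , NoLowFixFrom-++⁺ (suc i) u w nf-u (subst (λ j → NoLowFixFrom e j w) (+-suc i (length u)) nf-w)

NoLowFixFrom-map : ∀ {e} (f : ℕ → ℕ) → (∀ {x j} → f x ≡ j → j ≤ e → x ≡ j) →
  ∀ i p → NoLowFixFrom e i p → NoLowFixFrom e i (map f p)
NoLowFixFrom-map f f-low i []       _                = tt
NoLowFixFrom-map {e} f f-low i (x ∷ xs) (above , nf) = above′ , NoLowFixFrom-map f f-low (suc i) xs nf
  where
  above′ : f x ≡ i → e < i
  above′ fx≡i with e <? i
  ... | yes e<i = e<i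
  ... | no  e≮i = above (f-low fx≡i (≮⇒≥ e≮i))

fixedPoint : ∀ {e} i p → NoLowFixFrom e i p → ¬ NoLowFixFrom (suc e) i p →
  ∃₂ λ u v → p ≡ u ++ suc e ∷ v × i + length u ≡ suc e
fixedPoint i [] _ ¬nf = ⊥-elim (¬nf tt)
fixedPoint {e} i (x ∷ xs) (above , nf) ¬nf′ with (x ≟ i) →-dec (suc e <? i)
... | yes above′ with fixedPoint (suc i) xs nf (λ nf′ → ¬nf′ (above′ , nf′))
...   | u , v , refl , i+|u|≡ = x ∷ u , v , refl , trans (+-suc i (length u)) i+|u|≡
fixedPoint {e} i (x ∷ xs) (above , nf) ¬nf′ | no ¬above′ with x ≟ i
... | no  x≢i  = ⊥-elim (¬above′ (λ x≡i → ⊥-elim (x≢i x≡i)))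
... | yes refl with ≤-antisym (above refl) (≮⇒≥ (λ e+1<x → ¬above′ (λ _ → e+1<x)))
...   | refl = [] , xs , refl , +-identityʳ (suc e)

-- NoFix lists the positions as applyUpTo suc; generalising to any f with f j ≡ i + j lets the induction go through.
NoLowFixFrom⇒zip : ∀ {e} (f : ℕ → ℕ) i p → (∀ j → f j ≡ i + j) → i + length p ≤ suc e →
  NoLowFixFrom e i p → All (λ (q : ℕ × ℕ) → proj₁ q ≢ proj₂ q) (zip p (applyUpTo f (length p)))
NoLowFixFrom⇒zip f i []       _  _     _            = []
NoLowFixFrom⇒zip f i (x ∷ xs) f≡ bound (above , nf) =
  (λ x≡f0 → <⇒≱ (above (trans x≡f0 (trans (f≡ 0) (+-identityʳ i)))) (≤-pred (≤-trans (s≤s (m≤m+n i (length xs))) bound′))) ∷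
  NoLowFixFrom⇒zip (f ∘ suc) (suc i) xs (λ j → trans (f≡ (suc j)) (+-suc i j)) bound′ nf
  where
  bound′ : suc i + length xs ≤ suc _
  bound′ = ≤-trans (≤-reflexive (sym (+-suc i (length xs)))) bound

zip⇒NoLowFixFrom : ∀ {e} (f : ℕ → ℕ) i p → (∀ j → f j ≡ i + j) →
  All (λ (q : ℕ × ℕ) → proj₁ q ≢ proj₂ q) (zip p (applyUpTo f (length p))) → NoLowFixFrom e i p
zip⇒NoLowFixFrom f i []       _  _            = tt
zip⇒NoLowFixFrom f i (x ∷ xs) f≡ (x≢f0 ∷ nfs) =
  (λ x≡i → ⊥-elim (x≢f0 (trans x≡i (sym (trans (f≡ 0) (+-identityʳ i)))))) ,
  zip⇒NoLowFixFrom (f ∘ suc) (suc i) xs (λ j → trans (f≡ (suc j)) (+-suc i j)) nfs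

-- The perms counted at e but not at e + 1 have their first fixed point at t = e + 1; deleting it
-- and closing the gap maps them bijectively onto the perms of [N] counted at e.
module FixedPointRecurrence {e N : ℕ} (t≤1+N : suc e ≤ suc N) where

  private
    t : ℕ
    t = suc e

    lost? : Decidable (NoLowFix e ∩ ∁ (NoLowFix (suc e)))
    lost? = noLowFixFrom? e 1 ∩? ∁? (noLowFixFrom? (suc e) 1)

    to : List ℕ → List ℕ
    to = closeGap t

    from : List ℕ → List ℕ
    from q = take e (map (punchIn t) q) ++ t ∷ drop e (map (punchIn t) q)

    punch-low : ∀ {f : ℕ → ℕ → ℕ} → (∀ {s x i} → f s x ≡ i → i < s → x ≡ i) → ∀ {x j} → f t x ≡ j → j ≤ e → x ≡ j
    punch-low f-low fx≡j j≤e = f-low fx≡j (s≤s j≤e)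

    fixed : ∀ {p} → p ∈ filter lost? (perms (suc N)) → ∃₂ λ u v → p ≡ u ++ t ∷ v × length u ≡ e
    fixed {p} p∈ with ∈-filter⁻ lost? {xs = perms (suc N)} p∈
    ... | _ , nf , ¬nf′ with fixedPoint 1 p nf ¬nf′
    ... | u , v , p≡ , 1+|u|≡ = u , v , p≡ , suc-injective 1+|u|≡

    to-∈ : ∀ {p} → p ∈ filter lost? (perms (suc N)) → to p ∈ filter (noLowFixFrom? e 1) (perms N)
    to-∈ {p} p∈ with ∈-filter⁻ lost? {xs = perms (suc N)} p∈ | fixed p∈
    ... | p∈perms , nf , _ | u , v , refl , refl = ∈-filter⁺ (noLowFixFrom? e 1) (∈-perms⁺ (IsPerm-closeGap u v π))
      (subst (NoLowFix e) (sym (closeGap-mid u v (proj₁ (Unique-remove u v (IsPerm.unique π)))))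
        (NoLowFixFrom-map (punchOut t) (punch-low punchOut-≡-<) 1 (u ++ v)
          (NoLowFixFrom-++⁺ 1 u v (proj₁ (NoLowFixFrom-++⁻ 1 u (t ∷ v) nf)) (NoLowFixFrom-beyond ≤-refl v))))
      where π = ∈-perms⁻ {suc N} p∈perms

    from-∈ : ∀ {q} → q ∈ filter (noLowFixFrom? e 1) (perms N) → from q ∈ filter lost? (perms (suc N))
    from-∈ {q} q∈ with ∈-filter⁻ (noLowFixFrom? e 1) {xs = perms N} q∈
    ... | q∈perms , nf = ∈-filter⁺ lost?
      (∈-perms⁺ (IsPerm-openGap u v (s≤s z≤n , t≤1+N) (take++drop≡id e q↑) π))
      (NoLowFixFrom-++⁺ 1 u (t ∷ v) (proj₁ (NoLowFixFrom-++⁻ 1 u v (subst (NoLowFix e) (sym (take++drop≡id e q↑)) nf↑)))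
         (NoLowFixFrom-beyond (≤-reflexive (cong suc (sym |u|≡e))) (t ∷ v)) ,
       λ nf′ → <-irrefl (cong suc (sym |u|≡e)) (proj₁ (proj₂ (NoLowFixFrom-++⁻ 1 u (t ∷ v) nf′)) (cong suc (sym |u|≡e))))
      where
      π = ∈-perms⁻ {N} q∈perms
      q↑ = map (punchIn t) q
      u = take e q↑
      v = drop e q↑
      nf↑ : NoLowFix e q↑
      nf↑ = NoLowFixFrom-map (punchIn t) (punch-low punchIn-≡-<) 1 q nf
      |u|≡e : length u ≡ e
      |u|≡e = trans (length-take e q↑) (m≤n⇒m⊓n≡m (≤-trans (≤-pred t≤1+N) (≤-reflexive (sym |q↑|≡N))))
        where |q↑|≡N = trans (length-map (punchIn t) q) (IsPerm.length≡ π)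

    from∘to : ∀ {p} → p ∈ filter lost? (perms (suc N)) → from (to p) ≡ p
    from∘to {p} p∈ with ∈-filter⁻ lost? {xs = perms (suc N)} p∈ | fixed p∈
    ... | p∈perms , _ | u , v , refl , refl
      rewrite openGap-closeGap u v (proj₁ (Unique-remove u v (IsPerm.unique (∈-perms⁻ {suc N} p∈perms))))
      = cong₂ (λ u′ v′ → u′ ++ t ∷ v′) (take-++-length u v) (drop-++-length u v)

    to∘from : ∀ {q} → q ∈ filter (noLowFixFrom? e 1) (perms N) → to (from q) ≡ q
    to∘from {q} _ = closeGap-openGap (take e (map (punchIn t) q)) _ (take++drop≡id e (map (punchIn t) q))

  #NoLowFix-recurrence : #NoLowFix (suc N) e ≡ #NoLowFix (suc N) (suc e) + #NoLowFix N e
  #NoLowFix-recurrence = trans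
    (length-filter-⊆ (noLowFixFrom? (suc e) 1) (noLowFixFrom? e 1) (NoLowFixFrom-weaken 1 _) (perms (suc N)))
    (cong (#NoLowFix (suc N) (suc e) +_) (length-Bijection
      (Unique.filter⁺ lost? (Unique-perms (suc N))) (Unique.filter⁺ (noLowFixFrom? e 1) (Unique-perms N))
      (record { to = to ; from = from ; to-∈ = to-∈ ; from-∈ = from-∈ ; from∘to = from∘to ; to∘from = to∘from })))

recurrence-unique : ∀ c (f g : ℕ → ℕ → ℕ) →
  (∀ {N e} → suc e + c ≤ suc N → f (suc N) e ≡ f (suc N) (suc e) + f N e) →
  (∀ {N e} → suc e + c ≤ suc N → g (suc N) e ≡ g (suc N) (suc e) + g N e) →
  (∀ N → f N 0 ≡ g N 0) →
  ∀ {N e} → e + c ≤ N → f N e ≡ g N e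
recurrence-unique c f g f-rec g-rec base {N}     {zero}  _     = base N
recurrence-unique c f g f-rec g-rec base {suc N} {suc e} bound = +-cancelʳ-≡ _ _ _ (begin
  f (suc N) (suc e) + f N e ≡⟨ sym (f-rec bound) ⟩
  f (suc N) e               ≡⟨ recurrence-unique c f g f-rec g-rec base (m≤n⇒m≤1+n (≤-pred bound)) ⟩
  g (suc N) e               ≡⟨ g-rec bound ⟩
  g (suc N) (suc e) + g N e ≡⟨ cong (g (suc N) (suc e) +_) (sym (recurrence-unique c f g f-rec g-rec base (≤-pred bound))) ⟩
  g (suc N) (suc e) + f N e ∎)
  where open ≡-Reasoning

-- dᵉ m N e interpolates between N! (e = 0) and d m N (e = N ∸ m).
dᵉ : ℕ → ℕ → ℕ → ℕ
dᵉ zero    N e = #NoLowFix N e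
dᵉ (suc m) N e = #NoLowSucc false (suc m) N e

anchoredᵉ : ℕ → ℕ → ℕ → ℕ
anchoredᵉ m N e = #NoLowSucc true (suc m) (suc N) e

dᵉ-recurrence : ∀ m {N e} → suc e + m ≤ suc N → dᵉ m (suc N) e ≡ dᵉ m (suc N) (suc e) + dᵉ m N e
dᵉ-recurrence zero    bound = FixedPointRecurrence.#NoLowFix-recurrence (≤-trans (≤-reflexive (sym (+-identityʳ _))) bound)
dᵉ-recurrence (suc m) bound = SuccessionRecurrence.#NoLowSucc-recurrence false (s≤s z≤n) bound

anchoredᵉ-recurrence : ∀ m {N e} → suc e + m ≤ suc N → anchoredᵉ m (suc N) e ≡ anchoredᵉ m (suc N) (suc e) + anchoredᵉ m N e
anchoredᵉ-recurrence m {N} {e} bound =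
  SuccessionRecurrence.#NoLowSucc-recurrence true (s≤s z≤n) (≤-trans (≤-reflexive (+-suc (suc e) m)) (s≤s bound))

dᵉ-zero : ∀ m N → dᵉ m N 0 ≡ length (perms N)
dᵉ-zero zero    N = cong length (filter-all (noLowFixFrom? 0 1) {xs = perms N}
  (All.tabulate (λ _ → NoLowFixFrom-beyond (s≤s z≤n) _)))
dᵉ-zero (suc m) N = cong length (filter-all (anchored? false ∩? noLowSucc? (suc m) 0) {xs = perms N}
  (All.tabulate (λ {p} p∈ → tt , NoLowSucc-positive p (All.map proj₁ (IsPerm.inRange (∈-perms⁻ {N} p∈))))))

-- A perm of [N + 1] starting with 1 is 1 followed by a relabelled perm of [N].
anchoredᵉ-zero : ∀ m N → anchoredᵉ m N 0 ≡ length (perms N)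
anchoredᵉ-zero m N = length-Bijection (Unique.filter⁺ counted? (Unique-perms (suc N))) (Unique-perms N) (record
  { to      = closeGap 1
  ; from    = λ q → 1 ∷ map (punchIn 1) q
  ; to-∈    = to-∈
  ; from-∈  = from-∈
  ; from∘to = from∘to
  ; to∘from = λ {q} _ → closeGap-openGap [] (map (punchIn 1) q) refl
  })
  where
  counted? = anchored? true ∩? noLowSucc? (suc m) 0
  to-∈ : ∀ {p} → p ∈ filter counted? (perms (suc N)) → closeGap 1 p ∈ perms N
  to-∈ {p} p∈ with ∈-filter⁻ counted? {xs = perms (suc N)} p∈
  to-∈ {1 ∷ r} p∈ | p∈perms , refl , _ = ∈-perms⁺ (IsPerm-closeGap {N} [] r (∈-perms⁻ p∈perms))
  from-∈ : ∀ {q} → q ∈ perms N → (1 ∷ map (punchIn 1) q) ∈ filter counted? (perms (suc N))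
  from-∈ {q} q∈ = ∈-filter⁺ counted? (∈-perms⁺ π) (refl , NoLowSucc-positive _ (All.map proj₁ (IsPerm.inRange π)))
    where π = IsPerm-openGap {N} {1} [] (map (punchIn 1) q) (≤-refl , s≤s z≤n) refl (∈-perms⁻ q∈)
  from∘to : ∀ {p} → p ∈ filter counted? (perms (suc N)) → 1 ∷ map (punchIn 1) (closeGap 1 p) ≡ p
  from∘to {p} p∈ with ∈-filter⁻ counted? {xs = perms (suc N)} p∈
  from∘to {1 ∷ r} p∈ | p∈perms , refl , _ =
    cong (1 ∷_) (openGap-closeGap {1} [] r (proj₁ (Unique-remove [] r (IsPerm.unique (∈-perms⁻ {suc N} p∈perms)))))

anchoredᵉ≡dᵉ : ∀ m {N e} → e + m ≤ N → anchoredᵉ m N e ≡ dᵉ m N e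
anchoredᵉ≡dᵉ m = recurrence-unique m (anchoredᵉ m) (dᵉ m) (anchoredᵉ-recurrence m) (dᵉ-recurrence m)
  (λ N → trans (anchoredᵉ-zero m N) (sym (dᵉ-zero m N)))

dᵉ-top : ∀ m N → dᵉ m N (N ∸ m) ≡ d m N
dᵉ-top zero    N = length-filter-congOn (noLowFixFrom? N 1) noFix? (perms N)
  (λ {p} p∈ → NoLowFixFrom⇒zip suc 1 p (λ _ → refl) (s≤s (≤-reflexive (IsPerm.length≡ (∈-perms⁻ {N} p∈)))))
  (λ {p} _  → zip⇒NoLowFixFrom suc 1 p (λ _ → refl))
dᵉ-top (suc m) N = length-filter-congOn
  (anchored? false ∩? noLowSucc? (suc m) (N ∸ suc m)) (λ p → all? (notSucc? (suc m)) (adjPairs p)) (perms N)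
  (λ {p} p∈ (_ , above) → NoLowSucc⇒NoSucc p (All.map proj₂ (IsPerm.inRange (∈-perms⁻ {N} p∈))) above)
  (λ {p} _ noSucc → tt , NoSucc⇒NoLowSucc p noSucc)

-- Rotations

circPairs : List ℕ → List (ℕ × ℕ)
circPairs p = adjPairs p ++ wrapPair p

adjPairs-∷ʳ : ∀ y ys (z : ℕ) → adjPairs (y ∷ ys) ++ [ (lastOf y ys , z) ] ≡ adjPairs (y ∷ ys ++ [ z ])
adjPairs-∷ʳ y []        z = refl
adjPairs-∷ʳ y (y′ ∷ ys) z = cong ((y , y′) ∷_) (adjPairs-∷ʳ y′ ys z)

-- Cutting the cycle a₀ a′ c₀ c′ (back to a₀) at a₀ and at c₀.
circPairs-++ : ∀ a₀ a′ c₀ c′ → circPairs (a₀ ∷ a′ ++ c₀ ∷ c′) ≡ adjPairs (a₀ ∷ a′ ++ [ c₀ ]) ++ adjPairs (c₀ ∷ c′ ++ [ a₀ ])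
circPairs-++ a₀ a′ c₀ c′ = begin
  circPairs (a₀ ∷ a′ ++ c₀ ∷ c′)               ≡⟨ adjPairs-∷ʳ a₀ (a′ ++ c₀ ∷ c′) a₀ ⟩
  adjPairs (a₀ ∷ (a′ ++ c₀ ∷ c′) ++ [ a₀ ])    ≡⟨ cong (adjPairs ∘ (a₀ ∷_)) (++-assoc a′ (c₀ ∷ c′) [ a₀ ]) ⟩
  adjPairs ((a₀ ∷ a′) ++ c₀ ∷ c′ ++ [ a₀ ])    ≡⟨ adjPairs-++-∷ (a₀ ∷ a′) c₀ (c′ ++ [ a₀ ]) ⟩
  adjPairs (a₀ ∷ a′ ++ [ c₀ ]) ++ adjPairs (c₀ ∷ c′ ++ [ a₀ ]) ∎
  where open ≡-Reasoning

circPairs-rotate : ∀ a c → circPairs (a ++ c) ↭ circPairs (c ++ a)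
circPairs-rotate []         c          = ↭-reflexive (cong circPairs (sym (++-identityʳ c)))
circPairs-rotate (a₀ ∷ a′) []          = ↭-reflexive (cong circPairs (++-identityʳ (a₀ ∷ a′)))
circPairs-rotate (a₀ ∷ a′) (c₀ ∷ c′) = begin
  circPairs (a₀ ∷ a′ ++ c₀ ∷ c′)                               ≡⟨ circPairs-++ a₀ a′ c₀ c′ ⟩
  adjPairs (a₀ ∷ a′ ++ [ c₀ ]) ++ adjPairs (c₀ ∷ c′ ++ [ a₀ ]) ↭⟨ ++-comm (adjPairs (a₀ ∷ a′ ++ [ c₀ ])) _ ⟩
  adjPairs (c₀ ∷ c′ ++ [ a₀ ]) ++ adjPairs (a₀ ∷ a′ ++ [ c₀ ]) ≡⟨ circPairs-++ c₀ c′ a₀ a′ ⟨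
  circPairs (c₀ ∷ c′ ++ a₀ ∷ a′)                               ∎
  where open PermutationReasoning

NoCircSucc-rotate : ∀ {k} a c → NoCircSucc k (a ++ c) → NoCircSucc k (c ++ a)
NoCircSucc-rotate a c = All-resp-↭ (circPairs-rotate a c)

IsPerm-rotate : ∀ {n} a c → IsPerm n (a ++ c) → IsPerm n (c ++ a)
IsPerm-rotate a c π = record
  { unique  = Unique-resp-↭ (++-comm a c) unique
  ; length≡ = trans (length-++-comm c a) length≡
  ; inRange = All-resp-↭ (++-comm a c) inRange
  }
  where open IsPerm π

break-mid : ∀ a b → 1 ∉ a → break (_≟ 1) (a ++ 1 ∷ b) ≡ (a , 1 ∷ b)
break-mid []      b _  = refl
break-mid (0 ∷ a)           b 1∉ = cong (Product.map₁ (0 ∷_)) (break-mid a b (1∉ ∘ there))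
break-mid (1 ∷ a)           b 1∉ = ⊥-elim (1∉ (here refl))
break-mid (suc (suc y) ∷ a) b 1∉ = cong (Product.map₁ (suc (suc y) ∷_)) (break-mid a b (1∉ ∘ there))

noCircSucc? : ∀ k p → Dec (NoCircSucc k p)
noCircSucc? k p = all? (notSucc? k) (circPairs p)

#AnchoredNoCircSucc : ℕ → ℕ → ℕ
#AnchoredNoCircSucc k n = length (filter (anchored? true ∩? noCircSucc? k) (perms n))

-- Rotating a circular arrangement to start at 1 and recording where 1 was.
module Rotation (k n₀ : ℕ) where

  private
    n : ℕ
    n = suc n₀

    anchoredCircular? : Decidable (Anchored true ∩ NoCircSucc k)
    anchoredCircular? = anchored? true ∩? noCircSucc? k

    Circular AnchoredCircular : List (List ℕ)
    Circular = filter (noCircSucc? k) (perms n)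
    AnchoredCircular   = filter anchoredCircular? (perms n)

    to : List ℕ → List ℕ × ℕ
    to p = let (a , c) = break (_≟ 1) p in c ++ a , length c

    from : List ℕ × ℕ → List ℕ
    from (q , j) = drop j q ++ take j q

    at1 : ∀ {p} → IsPerm n p → ∃₂ λ a b → p ≡ a ++ 1 ∷ b × 1 ∉ a
    at1 π with ∈-∃++ (∈-IsPerm π (≤-refl , s≤s z≤n))
    ... | a , b , refl = a , b , refl , Unique-∉ˡ a b (IsPerm.unique π)

    to-mid : ∀ a b → 1 ∉ a → to (a ++ 1 ∷ b) ≡ ((1 ∷ b) ++ a , suc (length b))
    to-mid a b 1∉a rewrite break-mid a b 1∉a = refl

    to-∈ : ∀ {p} → p ∈ Circular → to p ∈ cartesianProduct AnchoredCircular (range n)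
    to-∈ {p} p∈ with ∈-filter⁻ (noCircSucc? k) {xs = perms n} p∈
    ... | p∈perms , circ with at1 (∈-perms⁻ {n} p∈perms)
    ... | a , b , refl , 1∉a rewrite to-mid a b 1∉a = ∈-cartesianProduct⁺
      (∈-filter⁺ anchoredCircular? (∈-perms⁺ (IsPerm-rotate a (1 ∷ b) π)) (refl , NoCircSucc-rotate a (1 ∷ b) circ))
      (∈-range⁺ (s≤s z≤n , ≤-trans (m≤n+m (suc (length b)) (length a)) (≤-reflexive |a|+|1∷b|≡n)))
      where
      π = ∈-perms⁻ {n} p∈perms
      |a|+|1∷b|≡n = trans (sym (length-++ a)) (IsPerm.length≡ π)

    from-∈ : ∀ {qj} → qj ∈ cartesianProduct AnchoredCircular (range n) → from qj ∈ Circular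
    from-∈ {q , j} qj∈ with ∈-cartesianProduct⁻ AnchoredCircular (range n) qj∈
    ... | q∈ , _ with ∈-filter⁻ anchoredCircular? {xs = perms n} q∈
    ... | q∈perms , _ , circ = ∈-filter⁺ (noCircSucc? k)
      (∈-perms⁺ (IsPerm-rotate (take j q) (drop j q) (subst (IsPerm n) (sym (take++drop≡id j q)) (∈-perms⁻ q∈perms))))
      (NoCircSucc-rotate (take j q) (drop j q) (subst (NoCircSucc k) (sym (take++drop≡id j q)) circ))

    from∘to : ∀ {p} → p ∈ Circular → from (to p) ≡ p
    from∘to {p} p∈ with at1 (∈-perms⁻ {n} (proj₁ (∈-filter⁻ (noCircSucc? k) {xs = perms n} p∈)))
    ... | a , b , refl , 1∉a = trans (cong from (to-mid a b 1∉a))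
      (cong₂ _++_ (drop-++-length (1 ∷ b) a) (take-++-length (1 ∷ b) a))

    to∘from : ∀ {qj} → qj ∈ cartesianProduct AnchoredCircular (range n) → to (from qj) ≡ qj
    to∘from {q , j} qj∈ with ∈-cartesianProduct⁻ AnchoredCircular (range n) qj∈
    ... | q∈ , j∈ with ∈-filter⁻ anchoredCircular? {xs = perms n} q∈ | ∈-range⁻ j∈
    to∘from {1 ∷ c , suc j} qj∈ | q∈ , j∈ | q∈perms , refl , _ | _ , j<n = begin
      to (drop j c ++ 1 ∷ take j c)                        ≡⟨ to-mid (drop j c) (take j c) 1∉drop ⟩
      (1 ∷ take j c ++ drop j c , suc (length (take j c))) ≡⟨ cong₂ (λ c′ l → 1 ∷ c′ , suc l) (take++drop≡id j c) |take| ⟩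
      (1 ∷ c , suc j)                                      ∎
      where
      open ≡-Reasoning
      π = ∈-perms⁻ {n} q∈perms
      1∉drop : 1 ∉ drop j c
      1∉drop = proj₁ (Unique-remove [] c (IsPerm.unique π)) ∘ subst (1 ∈_) (take++drop≡id j c) ∘ ∈-++⁺ʳ (take j c)
      |take| : length (take j c) ≡ j
      |take| = trans (length-take j c) (m≤n⇒m⊓n≡m (≤-pred (≤-trans j<n (≤-reflexive (sym (IsPerm.length≡ π))))))

  dstar-rotation : dstar k n ≡ #AnchoredNoCircSucc k n * n
  dstar-rotation = begin
    length Circular                                      ≡⟨ length-Bijection Circular! Product! rotation ⟩
    length (cartesianProduct AnchoredCircular (range n)) ≡⟨ length-cartesianProduct AnchoredCircular (range n) ⟩
    length AnchoredCircular * length (range n)           ≡⟨ cong (length AnchoredCircular *_) (length-applyUpTo suc n) ⟩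
    length AnchoredCircular * n                          ∎
    where
    open ≡-Reasoning
    Circular! = Unique.filter⁺ (noCircSucc? k) (Unique-perms n)
    Product! = Unique.cartesianProduct⁺ (Unique.filter⁺ anchoredCircular? (Unique-perms n)) (Unique-range n)
    rotation = record { to = to ; from = from ; to-∈ = to-∈ ; from-∈ = from-∈ ; from∘to = from∘to ; to∘from = to∘from }

lastOf-∈ : ∀ (x : ℕ) xs → lastOf x xs ∈ x ∷ xs
lastOf-∈ x []       = here refl
lastOf-∈ x (y ∷ xs) = there (lastOf-∈ y xs)

-- Closing up a perm that starts with 1 adds the pair (p(n), 1), which is never a succession.
#AnchoredNoCircSucc≡anchoredᵉ : ∀ k₀ n₀ → #AnchoredNoCircSucc (suc k₀) (suc n₀) ≡ anchoredᵉ k₀ n₀ (n₀ ∸ k₀)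
#AnchoredNoCircSucc≡anchoredᵉ k₀ n₀ = length-filter-congOn
  (anchored? true ∩? noCircSucc? (suc k₀)) (anchored? true ∩? noLowSucc? (suc k₀) (n₀ ∸ k₀)) (perms (suc n₀))
  (λ {p} _ (anchored , circ) → anchored , NoSucc⇒NoLowSucc p (All.++⁻ˡ (adjPairs p) circ))
  (λ {p} p∈ (anchored , above) → anchored , All.++⁺
     (NoLowSucc⇒NoSucc p (All.map proj₂ (IsPerm.inRange (∈-perms⁻ {suc n₀} p∈))) above)
     (wrap p (IsPerm.inRange (∈-perms⁻ {suc n₀} p∈)) anchored))
  where
  wrap : ∀ p → All (InRange (suc n₀)) p → Anchored true p → All (NotSucc (suc k₀)) (wrapPair p)
  wrap (1 ∷ xs) inRange refl = (λ 1≡ → <⇒≢ (s≤s (≤-trans 1≤last (m≤m+n _ k₀))) (trans 1≡ (+-suc _ k₀))) ∷ []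
    where 1≤last = proj₁ (All.lookup inRange (lastOf-∈ 1 xs))

proposition2p1 : (n k : ℕ) → 2 ≤ n → 1 ≤ k → k ≤ n ∸ 1 →
    dstar k n ≡ n * d (k ∸ 1) (n ∸ 1)
proposition2p1 zero     _        ()
proposition2p1 (suc n₀) zero     _ ()
proposition2p1 (suc n₀) (suc k₀) _ _ k<n₀ = begin
  dstar (suc k₀) (suc n₀)                        ≡⟨ Rotation.dstar-rotation (suc k₀) n₀ ⟩
  #AnchoredNoCircSucc (suc k₀) (suc n₀) * suc n₀ ≡⟨ *-comm _ (suc n₀) ⟩
  suc n₀ * #AnchoredNoCircSucc (suc k₀) (suc n₀) ≡⟨ cong (suc n₀ *_) (#AnchoredNoCircSucc≡anchoredᵉ k₀ n₀) ⟩
  suc n₀ * anchoredᵉ k₀ n₀ (n₀ ∸ k₀)               ≡⟨ cong (suc n₀ *_) (anchoredᵉ≡dᵉ k₀ (≤-reflexive (m∸n+n≡m (<⇒≤ k<n₀)))) ⟩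
  suc n₀ * dᵉ k₀ n₀ (n₀ ∸ k₀)                    ≡⟨ cong (suc n₀ *_) (dᵉ-top k₀ n₀) ⟩
  suc n₀ * d k₀ n₀                               ∎
  where open ≡-Reasoning
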